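{- Let $(\mathcal{C},\otimes,I)$ be a small semicartesian symmetric monoidal category (the unit $I$ is terminal), and write $!_A\colon A\to I$ for the unique morphisms. Let $\mathbf{X}=(X_0,X_1,\dots)$ be a sequence of objects and $\mathbf{I}=(I,I,\dots)$ the constant sequence. Then every observational sequence from $\mathbf{X}$ to $\mathbf{I}$ equals the discard sequence, namely the class of $(!_{X_n}\colon I\otimes X_n\to I\otimes I)_{n\in\mathbb{N}}$ (all memories equal to $I$).
   Context: Composition is written in diagrammatic order $;$ and coherence isomorphisms are suppressed; $M_{ -1}:=I$. A dinatural sequence from $\mathbf{X}$ to $\mathbf{Y}$ is a sequence of objects $(M_n)$ with morphisms $f_n\colon M_{n-1}\otimes X_n\to M_n\otimes Y_n$, modulo the equivalence generated by $(f_n;(r_n\otimes1))_n\sim((r_{n-1}\otimes1);f_n)_n$ for $f_n\colon M_{n-1}\otimes X_n\to N_n\otimes Y_n$, $r_n\colon N_n\to M_n$, $r_{ -1}=\mathrm{id}_I$. Its $n$-th truncation $\langle f_0|\dots|f_n\rangle$ is the class of $(f_0,\dots,f_n)$ under the analogous finite relation (where morphisms may also slide out after $f_n$). Two dinatural sequences are observationally equivalent if all their truncations coincide; an observational sequence is an equivalence class of dinatural sequences under observational equivalence. -}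

module Defs where

open import Level using (0ℓ)
open import Data.Nat using (ℕ; zero; suc)
open import Data.Product using (Σ; _,_)
open import Relation.Binary.Core using (Rel)
open import Relation.Binary.PropositionalEquality using (_≡_)
open import Relation.Binary.Construct.Closure.Equivalence using (EqClosure)

-- A small semicartesian symmetric monoidal category (hom-sets with
-- propositional equality; composition in diagrammatic order _⨾_).
record SemicartesianSMC : Set₁ where
  infixr 9 _⨾_
  infixr 10 _⊗₀_ _⊗₁_
  field
    Obj : Set
    _⇒_ : Obj → Obj → Set
    id  : ∀ {A} → A ⇒ A
    _⨾_ : ∀ {A B C} → A ⇒ B → B ⇒ C → A ⇒ C
    idˡ : ∀ {A B} (f : A ⇒ B) → id ⨾ f ≡ f
    idʳ : ∀ {A B} (f : A ⇒ B) → f ⨾ id ≡ f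
    assoc : ∀ {A B C D} (f : A ⇒ B) (g : B ⇒ C) (h : C ⇒ D) →
            (f ⨾ g) ⨾ h ≡ f ⨾ (g ⨾ h)
    _⊗₀_ : Obj → Obj → Obj
    _⊗₁_ : ∀ {A B C D} → A ⇒ B → C ⇒ D → (A ⊗₀ C) ⇒ (B ⊗₀ D)
    ⊗-id : ∀ {A B} → (id {A} ⊗₁ id {B}) ≡ id
    ⊗-⨾  : ∀ {A B C D E F} (f : A ⇒ B) (g : B ⇒ C) (h : D ⇒ E) (k : E ⇒ F) →
           ((f ⨾ g) ⊗₁ (h ⨾ k)) ≡ (f ⊗₁ h) ⨾ (g ⊗₁ k)
    I : Obj
    α⇒ : ∀ {A B C} → ((A ⊗₀ B) ⊗₀ C) ⇒ (A ⊗₀ (B ⊗₀ C))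
    α⇐ : ∀ {A B C} → (A ⊗₀ (B ⊗₀ C)) ⇒ ((A ⊗₀ B) ⊗₀ C)
    α-isoˡ : ∀ {A B C} → α⇒ {A} {B} {C} ⨾ α⇐ ≡ id
    α-isoʳ : ∀ {A B C} → α⇐ {A} {B} {C} ⨾ α⇒ ≡ id
    α-natural : ∀ {A A' B B' C C'} (f : A ⇒ A') (g : B ⇒ B') (h : C ⇒ C') →
                ((f ⊗₁ g) ⊗₁ h) ⨾ α⇒ ≡ α⇒ ⨾ (f ⊗₁ (g ⊗₁ h))
    λ⇒ : ∀ {A} → (I ⊗₀ A) ⇒ A
    λ⇐ : ∀ {A} → A ⇒ (I ⊗₀ A)
    λ-isoˡ : ∀ {A} → λ⇒ {A} ⨾ λ⇐ ≡ id
    λ-isoʳ : ∀ {A} → λ⇐ {A} ⨾ λ⇒ ≡ id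
    λ-natural : ∀ {A B} (f : A ⇒ B) → (id ⊗₁ f) ⨾ λ⇒ ≡ λ⇒ ⨾ f
    ρ⇒ : ∀ {A} → (A ⊗₀ I) ⇒ A
    ρ⇐ : ∀ {A} → A ⇒ (A ⊗₀ I)
    ρ-isoˡ : ∀ {A} → ρ⇒ {A} ⨾ ρ⇐ ≡ id
    ρ-isoʳ : ∀ {A} → ρ⇐ {A} ⨾ ρ⇒ ≡ id
    ρ-natural : ∀ {A B} (f : A ⇒ B) → (f ⊗₁ id) ⨾ ρ⇒ ≡ ρ⇒ ⨾ f
    σ : ∀ {A B} → (A ⊗₀ B) ⇒ (B ⊗₀ A)
    σ-natural : ∀ {A A' B B'} (f : A ⇒ A') (g : B ⇒ B') →
                (f ⊗₁ g) ⨾ σ ≡ σ ⨾ (g ⊗₁ f)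
    σ-involutive : ∀ {A B} → σ {A} {B} ⨾ σ ≡ id
    triangle : ∀ {A B} → α⇒ {A} {I} {B} ⨾ (id ⊗₁ λ⇒) ≡ (ρ⇒ ⊗₁ id)
    pentagon : ∀ {A B C D} →
               ((α⇒ {A} {B} {C} ⊗₁ id {D}) ⨾ α⇒ ⨾ (id ⊗₁ α⇒)) ≡ α⇒ ⨾ α⇒
    hexagon : ∀ {A B C} →
              (α⇒ {A} {B} {C} ⨾ σ ⨾ α⇒) ≡ (σ ⊗₁ id) ⨾ α⇒ ⨾ (id ⊗₁ σ)
    ! : ∀ {A} → A ⇒ I
    !-unique : ∀ {A} (f : A ⇒ I) → f ≡ !

module Streams (C : SemicartesianSMC) where
  open SemicartesianSMC C

  -- M_{-1} := I
  prev : (ℕ → Obj) → ℕ → Obj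
  prev M zero    = I
  prev M (suc n) = M n

  -- a representative of a dinatural sequence from X to Y
  record DinSeq (X Y : ℕ → Obj) : Set where
    field
      mem : ℕ → Obj
      mor : ∀ n → (prev mem n ⊗₀ X n) ⇒ (mem n ⊗₀ Y n)
  open DinSeq public

  -- finite tuples (f_0, …, f_n) whose last memory is the index Obj
  data Tup (X Y : ℕ → Obj) : ℕ → Obj → Set where
    one  : ∀ {M} → (I ⊗₀ X 0) ⇒ (M ⊗₀ Y 0) → Tup X Y 0 M
    snoc : ∀ {n M N} → Tup X Y n M → (M ⊗₀ X (suc n)) ⇒ (N ⊗₀ Y (suc n)) →
           Tup X Y (suc n) N

  -- Slide r t u : t = (g_k ⨾ (r_k ⊗ 1))_k  and  u = ((r_{k-1} ⊗ 1) ⨾ g_k)_k,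
  -- with r_{-1} = id_I and r = r_n the last sliding morphism.
  data Slide {X Y : ℕ → Obj} : ∀ {n M N} → N ⇒ M → Tup X Y n M → Tup X Y n N → Set where
    one  : ∀ {M N} (g : (I ⊗₀ X 0) ⇒ (N ⊗₀ Y 0)) (r : N ⇒ M) →
           Slide r (one (g ⨾ (r ⊗₁ id))) (one ((id ⊗₁ id) ⨾ g))
    snoc : ∀ {n M N M' N'} {r : N ⇒ M} {t : Tup X Y n M} {u : Tup X Y n N} →
           Slide r t u →
           (g : (M ⊗₀ X (suc n)) ⇒ (N' ⊗₀ Y (suc n))) (r' : N' ⇒ M') →
           Slide r' (snoc t (g ⨾ (r' ⊗₁ id))) (snoc u ((r ⊗₁ id) ⨾ g))

  SlideRel : (X Y : ℕ → Obj) (n : ℕ) → Rel (Σ Obj (Tup X Y n)) 0ℓ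
  SlideRel X Y n (M , t) (N , u) = Σ (N ⇒ M) λ r → Slide r t u

  TruncEq : (X Y : ℕ → Obj) (n : ℕ) → Rel (Σ Obj (Tup X Y n)) 0ℓ
  TruncEq X Y n = EqClosure (SlideRel X Y n)

  tuple : ∀ {X Y} (s : DinSeq X Y) (n : ℕ) → Tup X Y n (mem s n)
  tuple s zero    = one (mor s zero)
  tuple s (suc n) = snoc (tuple s n) (mor s (suc n))

  truncation : ∀ {X Y} (s : DinSeq X Y) (n : ℕ) → Σ Obj (Tup X Y n)
  truncation s n = (mem s n , tuple s n)

  ObsEq : ∀ {X Y} → DinSeq X Y → DinSeq X Y → Set
  ObsEq {X} {Y} s s' = ∀ n → TruncEq X Y n (truncation s n) (truncation s' n)

  𝐈 : ℕ → Obj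
  𝐈 _ = I

  -- the discard sequence: all memories I, f_n = !_{X_n} : I ⊗ X_n → I ⊗ I
  -- (coherence made explicit: λ ⨾ ! ⨾ λ⁻¹)
  discardMor : (X : ℕ → Obj) (n : ℕ) → (prev (λ _ → I) n ⊗₀ X n) ⇒ (I ⊗₀ I)
  discardMor X zero    = λ⇒ ⨾ ! ⨾ λ⇐
  discardMor X (suc n) = λ⇒ ⨾ ! ⨾ λ⇐

  discard : (X : ℕ → Obj) → DinSeq X 𝐈
  discard X = record { mem = λ _ → I ; mor = discardMor X }

-- Since I is terminal and I ⊗ I ≅ I, there is exactly one morphism into I ⊗ I from
-- any object. Sliding !_M out of the last component of a truncation therefore
-- replaces its final memory by I and its final morphism by the unique one; by
-- induction on the length every truncation is related to that of the discard
-- sequence.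
module Submission where

open import Defs
open import Data.Nat using (ℕ; zero; suc)
open import Data.Product using (Σ; _,_)
open import Relation.Binary.PropositionalEquality
open import Relation.Binary.Construct.Closure.Equivalence as EqClosure using ()
open import Relation.Binary.Construct.Closure.ReflexiveTransitive using (_◅◅_)

module Slides (C : SemicartesianSMC) {X Y : ℕ → SemicartesianSMC.Obj C} where
  open SemicartesianSMC C
  open Streams C

  idˡ-⊗ : ∀ {A B D} (f : (A ⊗₀ B) ⇒ D) → (id ⊗₁ id) ⨾ f ≡ f
  idˡ-⊗ f = trans (cong (_⨾ f) ⊗-id) (idˡ f)

  idʳ-⊗ : ∀ {A B D} (f : A ⇒ (B ⊗₀ D)) → f ⨾ (id ⊗₁ id) ≡ f
  idʳ-⊗ f = trans (cong (f ⨾_) ⊗-id) (idʳ f)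

  slide-one : ∀ {M N} (g : (I ⊗₀ X 0) ⇒ (N ⊗₀ Y 0)) (r : N ⇒ M) {a b} →
              a ≡ g ⨾ (r ⊗₁ id) → b ≡ (id ⊗₁ id) ⨾ g → Slide {X} {Y} r (one a) (one b)
  slide-one g r refl refl = one g r

  slide-snoc : ∀ {n M N M' N'} {r : N ⇒ M} {t : Tup X Y n M} {u : Tup X Y n N} →
               Slide r t u → (g : (M ⊗₀ X (suc n)) ⇒ (N' ⊗₀ Y (suc n))) (r' : N' ⇒ M') →
               ∀ {a b} → a ≡ g ⨾ (r' ⊗₁ id) → b ≡ (r ⊗₁ id) ⨾ g →
               Slide r' (snoc t a) (snoc u b)
  slide-snoc s g r' refl refl = snoc s g r'

  slide-id : ∀ {n M} (t : Tup X Y n M) → Slide id t t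
  slide-id (one f)    = slide-one f id (sym (idʳ-⊗ f)) (sym (idˡ-⊗ f))
  slide-id (snoc t f) = slide-snoc (slide-id t) f id (sym (idʳ-⊗ f)) (sym (idˡ-⊗ f))

module Discard (C : SemicartesianSMC) (X : ℕ → SemicartesianSMC.Obj C) where
  open SemicartesianSMC C
  open Streams C
  open Slides C {X} {𝐈}

  discardTo : ∀ {A} → A ⇒ (I ⊗₀ I)
  discardTo = ! ⨾ λ⇐

  ⇒I⊗I-unique : ∀ {A} (h : A ⇒ (I ⊗₀ I)) → h ≡ discardTo
  ⇒I⊗I-unique h = begin
    h                ≡⟨ sym (idʳ h) ⟩
    h ⨾ id           ≡⟨ cong (h ⨾_) (sym λ-isoˡ) ⟩
    h ⨾ (λ⇒ ⨾ λ⇐)    ≡⟨ sym (assoc h λ⇒ λ⇐) ⟩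
    (h ⨾ λ⇒) ⨾ λ⇐    ≡⟨ cong (_⨾ λ⇐) (!-unique (h ⨾ λ⇒)) ⟩
    ! ⨾ λ⇐           ∎
    where open ≡-Reasoning

  ⇒I⊗I-irrelevant : ∀ {A} (h k : A ⇒ (I ⊗₀ I)) → h ≡ k
  ⇒I⊗I-irrelevant h k = trans (⇒I⊗I-unique h) (sym (⇒I⊗I-unique k))

  forget-one : ∀ {N} (f : (I ⊗₀ X 0) ⇒ (N ⊗₀ I)) (d : (I ⊗₀ X 0) ⇒ (I ⊗₀ I)) →
               SlideRel X 𝐈 0 (I , one d) (N , one f)
  forget-one f d = ! , slide-one f ! (⇒I⊗I-irrelevant _ _) (sym (idˡ-⊗ f))

  forget-snoc : ∀ {n M N} (t : Tup X 𝐈 n M)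
                (f : (M ⊗₀ X (suc n)) ⇒ (N ⊗₀ I)) (d : (M ⊗₀ X (suc n)) ⇒ (I ⊗₀ I)) →
                SlideRel X 𝐈 (suc n) (I , snoc t d) (N , snoc t f)
  forget-snoc t f d = ! , slide-snoc (slide-id t) f ! (⇒I⊗I-irrelevant _ _) (sym (idˡ-⊗ f))

  extend : ∀ {n} → Σ Obj (Tup X 𝐈 n) → Σ Obj (Tup X 𝐈 (suc n))
  extend (M , t) = (I , snoc t discardTo)

  extend-cong : ∀ {n} {s t : Σ Obj (Tup X 𝐈 n)} →
                TruncEq X 𝐈 n s t → TruncEq X 𝐈 (suc n) (extend s) (extend t)
  extend-cong = EqClosure.gmap extend lift
    where
    lift : ∀ {n} {s t : Σ Obj (Tup X 𝐈 n)} →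
           SlideRel X 𝐈 n s t → SlideRel X 𝐈 (suc n) (extend s) (extend t)
    lift (r , s) = id , slide-snoc s discardTo id (⇒I⊗I-irrelevant _ _) (⇒I⊗I-irrelevant _ _)

  truncEq-discard : ∀ {n M} (t : Tup X 𝐈 n M) → TruncEq X 𝐈 n (M , t) (truncation (discard X) n)
  truncEq-discard (one f) =
    EqClosure.symmetric _ (EqClosure.return (forget-one f discardTo))
    ◅◅ EqClosure.return (forget-one (discardMor X 0) discardTo)
  truncEq-discard {suc n} (snoc t f) =
    EqClosure.symmetric _ (EqClosure.return (forget-snoc t f discardTo))
    ◅◅ extend-cong (truncEq-discard t)
    ◅◅ EqClosure.return (forget-snoc (tuple (discard X) n) (discardMor X (suc n)) discardTo)

proposition6p8 : (C : SemicartesianSMC) (X : ℕ → SemicartesianSMC.Obj C) →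
    (s : Streams.DinSeq C X (Streams.𝐈 C)) → Streams.ObsEq C s (Streams.discard C X)
proposition6p8 C X s n = Discard.truncEq-discard C X (Streams.tuple C s n)
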